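{- Any permutation that can be produced by a deque can be produced by a canonical operation sequence.
   Context: A deque holds a sequence with a top end and a bottom end. Given input $1,2,\dots,n$, the operations are: $I_1$ (move the next input element to the top end), $I_2$ (move it to the bottom end), $O_1$ (remove the top element and append it to the output), $O_2$ (remove the bottom element and append it to the output). An operation sequence is a word over $\{I_1,I_2,O_1,O_2\}$ with equally many $I$ and $O$ letters in total and every prefix containing at least as many $I$ letters as $O$ letters; it produces the permutation given by the output. A tsip word is an operation sequence such that for each $j\in\{1,2\}$ the numbers of $I_j$ and $O_j$ are equal and every prefix has at least as many $I_j$ as $O_j$; a tsip sub-word of $w$ is a nonempty contiguous factor of $w$ that is a tsip word. An operation sequence $w$ is canonical if: it contains no factor $I_1O_2$ or $I_2O_1$ (outputs eagerly); every tsip sub-word of $w$ begins with $I_1$ (standard); whenever $I_2$ or $O_2$ occurs, the number of preceding $I$ letters exceeds the number of preceding $O$ letters by at least two (top happy). -}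

module Defs where

open import Data.Nat using (ℕ; zero; suc; _+_; _≤_)
open import Data.List using (List; []; _∷_; _++_; take; map; upTo; reverse)
open import Data.Maybe using (Maybe; just; nothing)
open import Data.Product using (_×_; ∃; ∃-syntax; _,_)
open import Data.Sum using (_⊎_)
open import Data.Bool using (Bool; true; false)
open import Relation.Binary.PropositionalEquality using (_≡_; _≢_)

-- The four deque operations.  The deque is a list whose head is the TOP end
-- and whose last element is the BOTTOM end.
data Op : Set where
  I₁ I₂ O₁ O₂ : Op

eqOp : Op → Op → Bool
eqOp I₁ I₁ = true
eqOp I₂ I₂ = true
eqOp O₁ O₁ = true
eqOp O₂ O₂ = true
eqOp _  _  = false

cnt : Op → List Op → ℕ
cnt x [] = 0
cnt x (y ∷ w) with eqOp x y
... | true  = suc (cnt x w)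
... | false = cnt x w

#I : List Op → ℕ
#I w = cnt I₁ w + cnt I₂ w

#O : List Op → ℕ
#O w = cnt O₁ w + cnt O₂ w

IsOpSeq : List Op → Set
IsOpSeq w = #I w ≡ #O w × (∀ k → #O (take k w) ≤ #I (take k w))

record State : Set where
  constructor st
  field
    input  : List ℕ
    deque  : List ℕ
    outRev : List ℕ

removeLast : List ℕ → Maybe (List ℕ × ℕ)
removeLast [] = nothing
removeLast (x ∷ []) = just ([] , x)
removeLast (x ∷ y ∷ xs) with removeLast (y ∷ xs)
... | nothing = nothing
... | just (ys , z) = just (x ∷ ys , z)

step : Op → State → Maybe State
step I₁ (st [] d o) = nothing
step I₁ (st (x ∷ i) d o) = just (st i (x ∷ d) o)
step I₂ (st [] d o) = nothing
step I₂ (st (x ∷ i) d o) = just (st i (d ++ (x ∷ [])) o)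
step O₁ (st i [] o) = nothing
step O₁ (st i (x ∷ d) o) = just (st i d (x ∷ o))
step O₂ (st i d o) with removeLast d
... | nothing = nothing
... | just (d' , x) = just (st i d' (x ∷ o))

run : List Op → State → Maybe State
run [] s = just s
run (x ∷ w) s with step x s
... | nothing = nothing
... | just s' = run w s'

input : ℕ → List ℕ
input n = map suc (upTo n)

output : ℕ → List Op → Maybe (List ℕ)
output n w with run w (st (input n) [] [])
... | nothing = nothing
... | just (st _ _ o) = just (reverse o)

-- w is an operation sequence on input 1..n producing the permutation π
-- (given in one-line notation as the output list)
Produces : ℕ → List Op → List ℕ → Set
Produces n w π = IsOpSeq w × #I w ≡ n × output n w ≡ just π

IsTsip : List Op → Set
IsTsip w = IsOpSeq w
         × cnt I₁ w ≡ cnt O₁ w × cnt I₂ w ≡ cnt O₂ w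
         × (∀ k → cnt O₁ (take k w) ≤ cnt I₁ (take k w))
         × (∀ k → cnt O₂ (take k w) ≤ cnt I₂ (take k w))

Eager : List Op → Set
Eager w = ∀ (a b : List Op) → w ≢ a ++ I₁ ∷ O₂ ∷ b × w ≢ a ++ I₂ ∷ O₁ ∷ b

Standard : List Op → Set
Standard w = ∀ (a u b : List Op) → w ≡ a ++ u ++ b → u ≢ [] → IsTsip u →
             ∃[ u' ] u ≡ I₁ ∷ u'

TopHappy : List Op → Set
TopHappy w = ∀ (a b : List Op) (x : Op) → w ≡ a ++ x ∷ b → (x ≡ I₂ ⊎ x ≡ O₂) →
             #O a + 2 ≤ #I a

Canonical : List Op → Set
Canonical w = Eager w × Standard w × TopHappy w

DequeProducible : ℕ → List ℕ → Set
DequeProducible n π = ∃[ w ] Produces n w π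

module Submission where

-- Among all operation sequences leading from the initial configuration (input, deque, output)
-- to the final configuration of a given producing sequence, take the one that is least in the
-- lexicographic order induced by O₁ ≺ O₂ ≺ I₁ ≺ I₂; it can be computed greedily, because
-- reachability is decidable (each letter lowers 2·|input| + |deque| by one).  This word is
-- canonical: every violation can be rewritten locally into a word reaching the same configuration
-- with a ≺-smaller letter at the offending position.  I₁O₂ becomes O₂I₁ (or I₁O₁ on an empty
-- deque), I₂O₁ becomes O₁I₂ (or I₁O₁), I₂ or O₂ on a deque with fewer than two elements becomes
-- I₁ (mirroring the rest of the word) or O₁, and a tsip sub-word starting with I₂ becomes its
-- mirror image, which acts identically because it never touches the deque content it starts on.

open import Defs
open import Data.Nat using (ℕ; zero; suc; _+_; _≤_; _<_; z≤n; s≤s; _≟_)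
open import Data.Nat.Properties
  using (+-suc; +-comm; +-identityʳ; suc-injective; ≤-pred; ≤-trans; ≤-reflexive; m≤n+m;
         +-monoˡ-≤; +-cancelʳ-≡; module ≤-Reasoning)
open import Data.Nat.Tactic.RingSolver using (solve-∀)
open import Data.Nat.Induction using (<-wellFounded)
open import Data.List using (List; []; _∷_; _++_; _∷ʳ_; take; drop; map; reverse; length; initLast; _∷ʳ′_)
open import Data.List.Properties using (length-++; ++-assoc; unfold-reverse; reverse-++; ++-identityʳ; take++drop≡id; ≡-dec)
open import Data.Maybe using (Maybe; just; nothing; _>>=_)
import Data.Maybe as Maybe
open import Data.Product using (_×_; ∃-syntax; _,_)
open import Data.Sum using (_⊎_; inj₁; inj₂)
open import Data.Empty using (⊥; ⊥-elim)
open import Function using (_∘_)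
open import Induction.WellFounded using (Acc; acc)
open import Relation.Nullary using (Dec; yes; no; ¬_)
open import Relation.Nullary.Decidable using (map′; _⊎-dec_; _×-dec_)
open import Relation.Binary.PropositionalEquality

open State using (deque; outRev)

run-∷ : ∀ x v s → run (x ∷ v) s ≡ (step x s >>= run v)
run-∷ x v s with step x s
... | nothing = refl
... | just _  = refl

run-∷-step : ∀ x s {s′} v → step x s ≡ just s′ → run (x ∷ v) s ≡ run v s′
run-∷-step x s v e rewrite run-∷ x v s | e = refl

run-++ : ∀ u v s → run (u ++ v) s ≡ (run u s >>= run v)
run-++ []      v s = refl
run-++ (x ∷ u) v s rewrite run-∷ x (u ++ v) s | run-∷ x u s with step x s
... | nothing = refl
... | just s′ = run-++ u v s′

run-++⁻ : ∀ u v {s t} → run (u ++ v) s ≡ just t → ∃[ s′ ] run u s ≡ just s′ × run v s′ ≡ just t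
run-++⁻ u v {s} r rewrite run-++ u v s with run u s
... | just s′ = s′ , refl , r

run-++⁺ : ∀ u {v s s′ t} → run u s ≡ just s′ → run v s′ ≡ just t → run (u ++ v) s ≡ just t
run-++⁺ u {v} {s} r₁ r₂ rewrite run-++ u v s | r₁ = r₂

run-++-congˡ : ∀ u u′ v s → run u s ≡ run u′ s → run (u ++ v) s ≡ run (u′ ++ v) s
run-++-congˡ u u′ v s e rewrite run-++ u v s | run-++ u′ v s | e = refl

removeLast-∷ʳ : ∀ (xs : List ℕ) z → removeLast (xs ∷ʳ z) ≡ just (xs , z)
removeLast-∷ʳ []           z = refl
removeLast-∷ʳ (x ∷ [])     z = refl
removeLast-∷ʳ (x ∷ y ∷ xs) z rewrite removeLast-∷ʳ (y ∷ xs) z = refl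

step-O₂-∷ʳ : ∀ i (d : List ℕ) z o → step O₂ (st i (d ∷ʳ z) o) ≡ just (st i d (z ∷ o))
step-O₂-∷ʳ i d z o rewrite removeLast-∷ʳ d z = refl

length-∷ʳ : ∀ (xs : List ℕ) z → length (xs ∷ʳ z) ≡ suc (length xs)
length-∷ʳ xs z = trans (length-++ xs) (+-comm (length xs) 1)

#I-I₂ : ∀ v → #I (I₂ ∷ v) ≡ suc (#I v)
#I-I₂ v = +-suc (cnt I₁ v) (cnt I₂ v)

#O-O₂ : ∀ v → #O (O₂ ∷ v) ≡ suc (#O v)
#O-O₂ v = +-suc (cnt O₁ v) (cnt O₂ v)

run-input : ∀ v {s t} → run v s ≡ just t → length (State.input s) ≡ #I v + length (State.input t)
run-input []       refl = refl
run-input (I₁ ∷ v) {st (c ∷ i) d o} r = cong suc (run-input v r)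
run-input (I₂ ∷ v) {st (c ∷ i) d o} r rewrite #I-I₂ v = cong suc (run-input v r)
run-input (O₁ ∷ v) {st i (c ∷ d) o} r = run-input v r
run-input (O₂ ∷ v) {st i d o} r with initLast d
... | ds ∷ʳ′ z rewrite step-O₂-∷ʳ i ds z o = run-input v r

run-deque : ∀ v {s t} → run v s ≡ just t → length (deque s) + #I v ≡ length (deque t) + #O v
run-deque []       refl = refl
run-deque (I₁ ∷ v) {st (c ∷ i) d o} r = trans (+-suc (length d) (#I v)) (run-deque v r)
run-deque (I₂ ∷ v) {st (c ∷ i) d o} r rewrite #I-I₂ v =
  trans (+-suc (length d) (#I v)) (trans (cong (_+ #I v) (sym (length-∷ʳ d c))) (run-deque v r))
run-deque (O₁ ∷ v) {st i (c ∷ d) o} {t} r =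
  trans (cong suc (run-deque v r)) (sym (+-suc (length (deque t)) (#O v)))
run-deque (O₂ ∷ v) {st i d o} {t} r with initLast d
... | ds ∷ʳ′ z rewrite step-O₂-∷ʳ i ds z o | #O-O₂ v | length-∷ʳ ds z =
  trans (cong suc (run-deque v r)) (sym (+-suc (length (deque t)) (#O v)))

mirrorOp : Op → Op
mirrorOp I₁ = I₂
mirrorOp I₂ = I₁
mirrorOp O₁ = O₂
mirrorOp O₂ = O₁

mirror : List Op → List Op
mirror = map mirrorOp

mirrorState : State → State
mirrorState (st i d o) = st i (reverse d) o

step-mirror : ∀ x s → step (mirrorOp x) (mirrorState s) ≡ Maybe.map mirrorState (step x s)
step-mirror I₁ (st []      d o) = refl
step-mirror I₁ (st (c ∷ i) d o) rewrite unfold-reverse c d = refl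
step-mirror I₂ (st []      d o) = refl
step-mirror I₂ (st (c ∷ i) d o) rewrite reverse-++ d (c ∷ []) = refl
step-mirror O₁ (st i []      o) = refl
step-mirror O₁ (st i (c ∷ d) o) rewrite unfold-reverse c d = step-O₂-∷ʳ i (reverse d) c o
step-mirror O₂ (st i d o) with initLast d
... | []       = refl
... | ds ∷ʳ′ z rewrite reverse-++ ds (z ∷ []) | step-O₂-∷ʳ i ds z o = refl

run-mirror : ∀ v s → run (mirror v) (mirrorState s) ≡ Maybe.map mirrorState (run v s)
run-mirror []      s = refl
run-mirror (x ∷ v) s
  rewrite run-∷ (mirrorOp x) (mirror v) (mirrorState s) | run-∷ x v s | step-mirror x s
  with step x s
... | nothing = refl
... | just s′ = run-mirror v s′

Balanced : ℕ → ℕ → List Op → Set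
Balanced t       b       []       = t ≡ 0 × b ≡ 0
Balanced t       b       (I₁ ∷ v) = Balanced (suc t) b v
Balanced t       b       (I₂ ∷ v) = Balanced t (suc b) v
Balanced zero    b       (O₁ ∷ v) = ⊥
Balanced (suc t) b       (O₁ ∷ v) = Balanced t b v
Balanced t       zero    (O₂ ∷ v) = ⊥
Balanced t       (suc b) (O₂ ∷ v) = Balanced t b v

balanced : ∀ t b v →
           (∀ k → cnt O₁ (take k v) ≤ t + cnt I₁ (take k v)) →
           (∀ k → cnt O₂ (take k v) ≤ b + cnt I₂ (take k v)) →
           cnt O₁ v ≡ t + cnt I₁ v → cnt O₂ v ≡ b + cnt I₂ v → Balanced t b v
balanced t b [] _ _ e₁ e₂ = sym (trans e₁ (+-identityʳ t)) , sym (trans e₂ (+-identityʳ b))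
balanced t b (I₁ ∷ v) p₁ p₂ e₁ e₂ =
  balanced (suc t) b v (λ k → ≤-trans (p₁ (suc k)) (≤-reflexive (+-suc t _))) (p₂ ∘ suc)
           (trans e₁ (+-suc t (cnt I₁ v))) e₂
balanced t b (I₂ ∷ v) p₁ p₂ e₁ e₂ =
  balanced t (suc b) v (p₁ ∘ suc) (λ k → ≤-trans (p₂ (suc k)) (≤-reflexive (+-suc b _)))
           e₁ (trans e₂ (+-suc b (cnt I₂ v)))
balanced zero b (O₁ ∷ v) p₁ p₂ e₁ e₂ with p₁ 1
... | ()
balanced (suc t) b (O₁ ∷ v) p₁ p₂ e₁ e₂ =
  balanced t b v (≤-pred ∘ p₁ ∘ suc) (p₂ ∘ suc) (suc-injective e₁) e₂
balanced t zero (O₂ ∷ v) p₁ p₂ e₁ e₂ with p₂ 1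
... | ()
balanced t (suc b) (O₂ ∷ v) p₁ p₂ e₁ e₂ =
  balanced t b v (p₁ ∘ suc) (≤-pred ∘ p₂ ∘ suc) e₁ (suc-injective e₂)

tsip-balanced : ∀ {u} → IsTsip u → Balanced 0 0 u
tsip-balanced {u} (_ , e₁ , e₂ , p₁ , p₂) = balanced 0 0 u p₁ p₂ (sym e₁) (sym e₂)

balanced-mirror : ∀ t b v → Balanced t b v → Balanced b t (mirror v)
balanced-mirror t       b       []       (t≡0 , b≡0) = b≡0 , t≡0
balanced-mirror t       b       (I₁ ∷ v) bal = balanced-mirror (suc t) b v bal
balanced-mirror t       b       (I₂ ∷ v) bal = balanced-mirror t (suc b) v bal
balanced-mirror (suc t) b       (O₁ ∷ v) bal = balanced-mirror t b v bal
balanced-mirror t       (suc b) (O₂ ∷ v) bal = balanced-mirror t b v bal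

-- The deque  top ++ D ++ reverse bottom  seen as two stacks around a middle part D that a
-- balanced word never touches.
record Split : Set where
  constructor split
  field
    remaining top bottom emitted : List ℕ

splitStep : Op → Split → Maybe Split
splitStep I₁ (split []      T B o)       = nothing
splitStep I₁ (split (c ∷ i) T B o)       = just (split i (c ∷ T) B o)
splitStep I₂ (split []      T B o)       = nothing
splitStep I₂ (split (c ∷ i) T B o)       = just (split i T (c ∷ B) o)
splitStep O₁ (split i       []      B o) = nothing
splitStep O₁ (split i       (c ∷ T) B o) = just (split i T B (c ∷ o))
splitStep O₂ (split i       T []      o) = nothing
splitStep O₂ (split i       T (c ∷ B) o) = just (split i T B (c ∷ o))

splitRun : List Op → Split → Maybe Split
splitRun []      σ = just σ
splitRun (x ∷ v) σ = splitStep x σ >>= splitRun v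

glue : List ℕ → Split → State
glue D (split i T B o) = st i (T ++ D ++ reverse B) o

swap : Split → Split
swap (split i T B o) = split i B T o

glue-∷ʳ : ∀ (T D B : List ℕ) c → (T ++ D ++ reverse B) ∷ʳ c ≡ T ++ D ++ reverse (c ∷ B)
glue-∷ʳ T D B c
  rewrite unfold-reverse c B | ++-assoc T (D ++ reverse B) (c ∷ []) | ++-assoc D (reverse B) (c ∷ []) = refl

run-glue : ∀ v D i T B o → Balanced (length T) (length B) v →
           run v (glue D (split i T B o)) ≡ Maybe.map (glue D) (splitRun v (split i T B o))
run-glue []       D i       T       B       o bal = refl
run-glue (I₁ ∷ v) D []      T       B       o bal = refl
run-glue (I₁ ∷ v) D (c ∷ i) T       B       o bal = run-glue v D i (c ∷ T) B o bal
run-glue (I₂ ∷ v) D []      T       B       o bal = refl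
run-glue (I₂ ∷ v) D (c ∷ i) T       B       o bal
  rewrite glue-∷ʳ T D B c = run-glue v D i T (c ∷ B) o bal
run-glue (O₁ ∷ v) D i       (c ∷ T) B       o bal = run-glue v D i T B (c ∷ o) bal
run-glue (O₂ ∷ v) D i       T       (c ∷ B) o bal
  rewrite sym (glue-∷ʳ T D B c) | step-O₂-∷ʳ i (T ++ D ++ reverse B) c o = run-glue v D i T B (c ∷ o) bal

splitRun-mirror : ∀ v σ → splitRun (mirror v) (swap σ) ≡ Maybe.map swap (splitRun v σ)
splitRun-mirror []       σ                     = refl
splitRun-mirror (I₁ ∷ v) (split []      T B o) = refl
splitRun-mirror (I₁ ∷ v) (split (c ∷ i) T B o) = splitRun-mirror v (split i (c ∷ T) B o)
splitRun-mirror (I₂ ∷ v) (split []      T B o) = refl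
splitRun-mirror (I₂ ∷ v) (split (c ∷ i) T B o) = splitRun-mirror v (split i T (c ∷ B) o)
splitRun-mirror (O₁ ∷ v) (split i []      B o) = refl
splitRun-mirror (O₁ ∷ v) (split i (c ∷ T) B o) = splitRun-mirror v (split i T B (c ∷ o))
splitRun-mirror (O₂ ∷ v) (split i T []      o) = refl
splitRun-mirror (O₂ ∷ v) (split i T (c ∷ B) o) = splitRun-mirror v (split i T B (c ∷ o))

-- A balanced run ends with both stacks empty, where swap is the identity.
swap-splitRun : ∀ v i T B o → Balanced (length T) (length B) v →
                Maybe.map swap (splitRun v (split i T B o)) ≡ splitRun v (split i T B o)
swap-splitRun []       i       [] [] o bal = refl
swap-splitRun (I₁ ∷ v) []      T B o bal = refl
swap-splitRun (I₁ ∷ v) (c ∷ i) T B o bal = swap-splitRun v i (c ∷ T) B o bal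
swap-splitRun (I₂ ∷ v) []      T B o bal = refl
swap-splitRun (I₂ ∷ v) (c ∷ i) T B o bal = swap-splitRun v i T (c ∷ B) o bal
swap-splitRun (O₁ ∷ v) i (c ∷ T) B o bal = swap-splitRun v i T B (c ∷ o) bal
swap-splitRun (O₂ ∷ v) i T (c ∷ B) o bal = swap-splitRun v i T B (c ∷ o) bal

tsip-mirror : ∀ {u} → IsTsip u → ∀ s → run (mirror u) s ≡ run u s
tsip-mirror {u} tsip (st i D o) =
  subst (λ d → run (mirror u) (st i d o) ≡ run u (st i d o)) (++-identityʳ D) (begin
    run (mirror u) (glue D σ₀)                         ≡⟨ run-glue (mirror u) D i [] [] o (balanced-mirror 0 0 u bal) ⟩
    Maybe.map (glue D) (splitRun (mirror u) (swap σ₀)) ≡⟨ cong (Maybe.map (glue D)) (splitRun-mirror u σ₀) ⟩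
    Maybe.map (glue D) (Maybe.map swap (splitRun u σ₀)) ≡⟨ cong (Maybe.map (glue D)) (swap-splitRun u i [] [] o bal) ⟩
    Maybe.map (glue D) (splitRun u σ₀)                 ≡⟨ sym (run-glue u D i [] [] o bal) ⟩
    run u (glue D σ₀)                                  ∎)
  where
  open ≡-Reasoning
  σ₀ : Split
  σ₀ = split i [] [] o
  bal : Balanced 0 0 u
  bal = tsip-balanced tsip

data _≺_ : Op → Op → Set where
  O₁≺O₂ : O₁ ≺ O₂
  O₁≺I₁ : O₁ ≺ I₁
  O₁≺I₂ : O₁ ≺ I₂
  O₂≺I₁ : O₂ ≺ I₁
  O₂≺I₂ : O₂ ≺ I₂
  I₁≺I₂ : I₁ ≺ I₂

Least : (Op → Set) → Op → Set
Least P x = P x × (∀ {y} → y ≺ x → ¬ P y)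

least? : {P : Op → Set} → (∀ x → Dec (P x)) → (∀ x → ¬ P x) ⊎ ∃[ x ] Least P x
least? P? with P? O₁ | P? O₂ | P? I₁ | P? I₂
... | yes p  | _      | _      | _      = inj₂ (O₁ , p , λ ())
... | no ¬p₁ | yes p  | _      | _      = inj₂ (O₂ , p , λ { O₁≺O₂ → ¬p₁ })
... | no ¬p₁ | no ¬p₂ | yes p  | _      = inj₂ (I₁ , p , λ { O₁≺I₁ → ¬p₁ ; O₂≺I₁ → ¬p₂ })
... | no ¬p₁ | no ¬p₂ | no ¬p₃ | yes p  = inj₂ (I₂ , p , λ { O₁≺I₂ → ¬p₁ ; O₂≺I₂ → ¬p₂ ; I₁≺I₂ → ¬p₃ })
... | no ¬p₁ | no ¬p₂ | no ¬p₃ | no ¬p₄ = inj₁ λ { O₁ → ¬p₁ ; O₂ → ¬p₂ ; I₁ → ¬p₃ ; I₂ → ¬p₄ }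

any? : {P : Op → Set} → (∀ x → Dec (P x)) → Dec (∃[ x ] P x)
any? P? with least? P?
... | inj₁ none          = no λ (x , p) → none x p
... | inj₂ (x , p , _)   = yes (x , p)

μ : State → ℕ
μ (st i d o) = length i + length i + length d

input-to-deque : ∀ a b → suc a + suc a + b ≡ suc (a + a + suc b)
input-to-deque = solve-∀

step-μ : ∀ x s {s′} → step x s ≡ just s′ → μ s ≡ suc (μ s′)
step-μ I₁ (st (c ∷ i) d o) refl = input-to-deque (length i) (length d)
step-μ I₂ (st (c ∷ i) d o) refl rewrite length-∷ʳ d c = input-to-deque (length i) (length d)
step-μ O₁ (st i (c ∷ d) o) refl = +-suc (length i + length i) (length d)
step-μ O₂ (st i d o) e with initLast d
... | ds ∷ʳ′ z rewrite step-O₂-∷ʳ i ds z o with e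
... | refl rewrite length-∷ʳ ds z = +-suc (length i + length i) (length ds)

_≟ₛ_ : (s t : State) → Dec (s ≡ t)
st i d o ≟ₛ st i′ d′ o′ =
  map′ (λ { (refl , refl , refl) → refl }) (λ { refl → refl , refl , refl })
       (≡-dec _≟_ i i′ ×-dec ≡-dec _≟_ d d′ ×-dec ≡-dec _≟_ o o′)

module GreedyTowards (g : State) where

  Reaches : State → Set
  Reaches s = ∃[ v ] run v s ≡ just g

  Viable : State → Op → Set
  Viable s y = ∃[ v ] run (y ∷ v) s ≡ just g

  reaches⁻ : ∀ {s} → Reaches s → s ≡ g ⊎ ∃[ y ] Viable s y
  reaches⁻ ([]    , refl) = inj₁ refl
  reaches⁻ (y ∷ v , r)    = inj₂ (y , v , r)

  reaches⁺ : ∀ {s} → s ≡ g ⊎ ∃[ y ] Viable s y → Reaches s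
  reaches⁺ (inj₁ refl)        = [] , refl
  reaches⁺ (inj₂ (y , v , r)) = y ∷ v , r

  mutual
    reaches? : ∀ s → Acc _<_ (μ s) → Dec (Reaches s)
    reaches? s ac = map′ reaches⁺ reaches⁻ ((s ≟ₛ g) ⊎-dec any? (viable? s ac))

    viable? : ∀ s → Acc _<_ (μ s) → ∀ y → Dec (Viable s y)
    viable? s (acc rs) y with step y s in e
    ... | nothing = no λ { (_ , ()) }
    ... | just s′ = reaches? s′ (rs (≤-reflexive (sym (step-μ y s e))))

  Greedy : State → List Op → Set
  Greedy s w = ∀ a x b {sa} → w ≡ a ++ x ∷ b → run a s ≡ just sa → ∀ {y} → y ≺ x → ¬ Viable sa y

  greedy-[] : ∀ {s} → Greedy s []
  greedy-[] []      _ _ ()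
  greedy-[] (_ ∷ _) _ _ ()

  greedy-∷ : ∀ {s x s′ w} → step x s ≡ just s′ → (∀ {y} → y ≺ x → ¬ Viable s y) →
             Greedy s′ w → Greedy s (x ∷ w)
  greedy-∷     e least G []      _ _ refl refl = least
  greedy-∷ {s} {x₀} e least G (_ ∷ a) x b refl ra = G a x b refl (trans (sym (run-∷-step x₀ s a e)) ra)

  greedy : ∀ s → Acc _<_ (μ s) → Reaches s → ∃[ w ] run w s ≡ just g × Greedy s w
  greedy s (acc rs) r with least? (viable? s (acc rs))
  ... | inj₁ none with reaches⁻ r
  ...   | inj₁ refl         = [] , refl , greedy-[]
  ...   | inj₂ (y , viable) = ⊥-elim (none y viable)
  greedy s (acc rs) r | inj₂ (x , (v , rv) , least) with step x s in e
  greedy s (acc rs) r | inj₂ (x , (v , ()) , least) | nothing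
  greedy s (acc rs) r | inj₂ (x , (v , rv) , least) | just s′
    with greedy s′ (rs (≤-reflexive (sym (step-μ x s e)))) (v , rv)
  ... | w , rw , G = x ∷ w , trans (run-∷-step x s w e) rw , greedy-∷ e least G

I₁O₂-commute : ∀ c i ds z o v →
               run (O₂ ∷ I₁ ∷ v) (st (c ∷ i) (ds ∷ʳ z) o) ≡ run (I₁ ∷ O₂ ∷ v) (st (c ∷ i) (ds ∷ʳ z) o)
I₁O₂-commute c i ds z o v =
  trans (run-∷-step O₂ (st (c ∷ i) (ds ∷ʳ z) o) (I₁ ∷ v) (step-O₂-∷ʳ (c ∷ i) ds z o))
        (sym (run-∷-step O₂ (st i (c ∷ ds ∷ʳ z) o) v (step-O₂-∷ʳ i (c ∷ ds) z o)))

module GreedyIsCanonical {gi go : List ℕ} where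
  open GreedyTowards (st gi [] go)

  bottom-move-needs-two : ∀ {x b sa} → x ≡ I₂ ⊎ x ≡ O₂ → run (x ∷ b) sa ≡ just (st gi [] go) →
                          (∀ {y} → y ≺ x → ¬ Viable sa y) → 2 ≤ length (deque sa)
  bottom-move-needs-two {sa = st []      d o}                (inj₁ refl) () _
  bottom-move-needs-two {b = b} {sa = st (c ∷ i) [] o}       (inj₁ refl) r least = ⊥-elim (least I₁≺I₂ (b , r))
  -- I₁ yields the reversed two-element deque; the mirror of the rest of the word, which
  -- ends at an empty deque, undoes the reversal.
  bottom-move-needs-two {b = b} {sa = st (c ∷ i) (e ∷ []) o} (inj₁ refl) r least =
    ⊥-elim (least I₁≺I₂ (mirror b , trans (run-mirror b (st i (e ∷ c ∷ []) o)) (cong (Maybe.map mirrorState) r)))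
  bottom-move-needs-two {sa = st (c ∷ i) (_ ∷ _ ∷ _) o}    (inj₁ refl) _ _ = s≤s (s≤s z≤n)
  bottom-move-needs-two {sa = st i []      o}              (inj₂ refl) () _
  bottom-move-needs-two {b = b} {sa = st i (e ∷ []) o}       (inj₂ refl) r least = ⊥-elim (least O₁≺O₂ (b , r))
  bottom-move-needs-two {sa = st i (_ ∷ _ ∷ _) o}          (inj₂ refl) _ _ = s≤s (s≤s z≤n)

  module _ {i₀ o₀ w} (rw : run w (st i₀ [] o₀) ≡ just (st gi [] go))
                     (G : Greedy (st i₀ [] o₀) w) where

    split-at : ∀ a r → w ≡ a ++ r →
               ∃[ sa ] run a (st i₀ [] o₀) ≡ just sa × run r sa ≡ just (st gi [] go)
    split-at a r refl = run-++⁻ a r rw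

    eager : Eager w
    eager a b = no-I₁O₂ , no-I₂O₁
      where
      no-I₁O₂ : w ≢ a ++ I₁ ∷ O₂ ∷ b
      no-I₁O₂ eq with split-at a _ eq
      ... | st []      d o , ra , ()
      ... | st (c ∷ i) d o , ra , r with initLast d
      ...   | []       = G (a ++ I₁ ∷ []) O₂ b (trans eq (sym (++-assoc a (I₁ ∷ []) (O₂ ∷ b))))
                           (run-++⁺ a ra refl) O₁≺O₂ (b , r)
      ...   | ds ∷ʳ′ z = G a I₁ (O₂ ∷ b) eq ra O₂≺I₁ (I₁ ∷ b , trans (I₁O₂-commute c i ds z o b) r)

      no-I₂O₁ : w ≢ a ++ I₂ ∷ O₁ ∷ b
      no-I₂O₁ eq with split-at a _ eq
      ... | st []      d       o , ra , ()
      ... | st (c ∷ i) []      o , ra , r = G a I₂ (O₁ ∷ b) eq ra I₁≺I₂ (O₁ ∷ b , r)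
      ... | st (c ∷ i) (_ ∷ _) o , ra , r = G a I₂ (O₁ ∷ b) eq ra O₁≺I₂ (I₂ ∷ b , r)

    standard : Standard w
    standard a []       b eq u≢[] _ = ⊥-elim (u≢[] refl)
    standard a (I₁ ∷ u) b eq _    _ = u , refl
    standard a (O₁ ∷ u) b eq _    (_ , _ , _ , p₁ , _) with p₁ 1
    ... | ()
    standard a (O₂ ∷ u) b eq _    (_ , _ , _ , _ , p₂) with p₂ 1
    ... | ()
    standard a (I₂ ∷ u) b eq _    tsip with split-at a _ eq
    ... | sa , ra , r = ⊥-elim (G a I₂ (u ++ b) eq ra I₁≺I₂ (mirror u ++ b , trans mirrored r))
      where
      mirrored : run (mirror (I₂ ∷ u) ++ b) sa ≡ run ((I₂ ∷ u) ++ b) sa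
      mirrored = run-++-congˡ (mirror (I₂ ∷ u)) (I₂ ∷ u) b sa (tsip-mirror tsip sa)

    topHappy : TopHappy w
    topHappy a b x eq bottom with split-at a (x ∷ b) eq
    ... | sa , ra , r = begin
      #O a + 2                  ≡⟨ +-comm (#O a) 2 ⟩
      2 + #O a                  ≤⟨ +-monoˡ-≤ (#O a) (bottom-move-needs-two bottom r (G a x b eq ra)) ⟩
      length (deque sa) + #O a  ≡⟨ sym (run-deque a ra) ⟩
      #I a                      ∎
      where open ≤-Reasoning

    canonical : Canonical w
    canonical = eager , standard , topHappy

run-opSeq : ∀ {w i o i′ o′} → run w (st i [] o) ≡ just (st i′ [] o′) → IsOpSeq w
run-opSeq {w} r = run-deque w r , prefix
  where
  prefix : ∀ k → #O (take k w) ≤ #I (take k w)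
  prefix k with run-++⁻ (take k w) (drop k w) (subst (λ u → run u _ ≡ _) (sym (take++drop≡id k w)) r)
  ... | sk , rk , _ = ≤-trans (m≤n+m _ (length (deque sk))) (≤-reflexive (sym (run-deque (take k w) rk)))

opSeq-final-deque : ∀ {w i o t} → IsOpSeq w → run w (st i [] o) ≡ just t → deque t ≡ []
opSeq-final-deque {w} {t = st _ d _} (I≡O , _) r =
  empty d (+-cancelʳ-≡ (#O w) (length d) 0 (trans (sym (run-deque w r)) I≡O))
  where
  empty : ∀ (xs : List ℕ) → length xs ≡ 0 → xs ≡ []
  empty [] _ = refl

run-#I-unique : ∀ w w′ {s t} → run w s ≡ just t → run w′ s ≡ just t → #I w ≡ #I w′
run-#I-unique w w′ {t = t} r r′ =
  +-cancelʳ-≡ (length (State.input t)) (#I w) (#I w′) (trans (sym (run-input w r)) (run-input w′ r′))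

output-run : ∀ n w → output n w ≡ (run w (st (input n) [] []) >>= λ s → just (reverse (outRev s)))
output-run n w with run w (st (input n) [] [])
... | nothing = refl
... | just _  = refl

output-cong : ∀ n w w′ → run w (st (input n) [] []) ≡ run w′ (st (input n) [] []) →
              output n w ≡ output n w′
output-cong n w w′ e rewrite output-run n w | output-run n w′ | e = refl

output-just : ∀ n w {π} → output n w ≡ just π → ∃[ g ] run w (st (input n) [] []) ≡ just g
output-just n w out with run w (st (input n) [] []) | output-run n w
... | just g  | _ = g , refl
... | nothing | e with trans (sym e) out
...   | ()

mainTheorem6 : (n : ℕ) (π : List ℕ) → DequeProducible n π →
               ∃[ w ] (Canonical w × Produces n w π)
mainTheorem6 n π (w₀ , opSeq₀ , #I₀≡n , out) with output-just n w₀ out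
... | st gi d go , r₀ with opSeq-final-deque opSeq₀ r₀
... | refl with GreedyTowards.greedy (st gi [] go) (st (input n) [] []) (<-wellFounded _) (w₀ , r₀)
... | w , rw , G =
  w , GreedyIsCanonical.canonical rw G ,
  run-opSeq rw , trans (run-#I-unique w w₀ rw r₀) #I₀≡n , trans (output-cong n w w₀ (trans rw (sym r₀))) out
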